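{- Let $G_1,G_2$ be graphs, $\overline{G}_1,\overline{G}_2$ their complements, and $k\ge1$ an integer. Then $\mathfrak{s}^k_{G_1}=\mathfrak{s}^k_{G_2}$ if and only if $\mathfrak{s}^k_{\overline G_1}=\mathfrak{s}^k_{\overline G_2}$.
   Context: Graphs are finite, simple, undirected, each on node set $\{1,\dots,n\}$ with $n\ge2$; the complement has the same node set and exactly the non-edges as edges. $N_G(i)$ is the set of neighbours of $i$; $\{\dots\}^\#$ denotes a multiset. For pairwise distinct nodes $i_1,\dots,i_k$ of $G=(V,E)$ define labels $L_l(i)$, $i\in V$, $l\ge0$: $L_0(i)=(\emptyset,\{c(i)\})$ where $c(i)=q$ if $i=i_q$ and $c(i)=0$ otherwise; for $l\ge1$, $L_l(i)=(L_{l-1}(i),\{L_{l-1}(i'):i'\in N_G(i)\}^\#)$; labels are compared by structural equality, also across graphs. $M^k_G(i_1,\dots,i_k)$ is the matrix with rows indexed by $V$, columns by $l\ge0$, with $(i,l)$ entry $L_l(i)$, and $\mathfrak{s}^k_G(i_1,\dots,i_k)$ is this matrix up to row permutation (the multiset of its rows). For $q=k-1,\dots,0$, $\mathfrak{s}^k_G(i_1,\dots,i_q)=\{\mathfrak{s}^k_G(i_1,\dots,i_q,i'):i'\in V\setminus\{i_1,\dots,i_q\}\}^\#$; the case $q=0$ is the fingerprint $\mathfrak{s}^k_G$. -}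

module Defs where

open import Data.Nat using (ℕ; zero; suc; _≤_)
open import Data.Bool using (Bool; true; false; not; _∧_; if_then_else_)
open import Data.Fin using (Fin; _≟_)
open import Data.List using (List; []; _∷_; map; filter; _++_; [_])
open import Data.List.Relation.Binary.Permutation.Homogeneous using (Permutation)
open import Data.List using (allFin)
open import Data.Product using (_×_)
open import Relation.Binary.PropositionalEquality using (_≡_; refl)
open import Relation.Nullary using (does; ¬?; yes; no)

record Graph : Set where
  field
    n     : ℕ
    2≤n   : 2 ≤ n
    adj   : Fin n → Fin n → Bool
    adj-sym : ∀ i j → adj i j ≡ adj j i
    irr   : ∀ i → adj i i ≡ false

open Graph public

_==_ : ∀ {n} → Fin n → Fin n → Bool
i == j = does (i ≟ j)

==-sym : ∀ {n} (i j : Fin n) → (i == j) ≡ (j == i)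
==-sym i j with i ≟ j | j ≟ i
... | yes _ | yes _ = refl
... | no _  | no _  = refl
... | yes refl | no ¬p = Data.Empty.⊥-elim (¬p refl) where import Data.Empty
... | no ¬p | yes refl = Data.Empty.⊥-elim (¬p refl) where import Data.Empty

==-refl : ∀ {n} (i : Fin n) → (i == i) ≡ true
==-refl i with i ≟ i
... | yes _ = refl
... | no ¬p = Data.Empty.⊥-elim (¬p refl) where import Data.Empty

complement : Graph → Graph
complement G = record
  { n   = n G
  ; 2≤n = 2≤n G
  ; adj = λ i j → not (i == j) ∧ not (adj G i j)
  ; adj-sym = λ i j → sym′ i j
  ; irr = λ i → irr′ i
  }
  where
  sym′ : ∀ i j → (not (i == j) ∧ not (adj G i j)) ≡ (not (j == i) ∧ not (adj G j i))
  sym′ i j rewrite ==-sym i j | Graph.adj-sym G i j = refl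
  irr′ : ∀ i → (not (i == i) ∧ not (adj G i i)) ≡ false
  irr′ i rewrite ==-refl i = refl

neighbours : (G : Graph) → Fin (n G) → List (Fin (n G))
neighbours G i = filter (λ j → Data.Bool.T? (adj G i j)) (allFin (n G))
  where import Data.Bool

-- Labels.  base c  represents L_0 = (∅, {c}) ;
-- step a xs represents (a, {xs}^#) with xs a multiset given by a list.

data Label : Set where
  base : ℕ → Label
  step : Label → List Label → Label

data _≈L_ : Label → Label → Set where
  base : ∀ {c d} → c ≡ d → base c ≈L base d
  step : ∀ {a b xs ys} → a ≈L b → Permutation _≈L_ xs ys → step a xs ≈L step b ys

-- Colour c(i) for the tuple (i_1,…,i_q) given as a list in order:
-- c(i) = q' if i = i_q', and 0 otherwise.
colour : ∀ {m} → List (Fin m) → Fin m → ℕ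
colour []       i = 0
colour (j ∷ js) i = if i == j then 1 else pos (colour js i)
  where
  pos : ℕ → ℕ
  pos zero    = zero
  pos (suc r) = suc (suc r)

L : (G : Graph) → List (Fin (n G)) → ℕ → Fin (n G) → Label
L G t zero    i = base (colour t i)
L G t (suc l) i = step (L G t l i) (map (L G t l) (neighbours G i))

Row : Set
Row = ℕ → Label

_≈R_ : Row → Row → Set
r ≈R r′ = ∀ l → r l ≈L r′ l

-- Fingerprint values with d remaining levels of nesting:
-- FP 0 = the matrix up to row permutation (list of rows, compared as multiset);
-- FP (suc d) = multiset of FP d.
FP : ℕ → Set
FP zero    = List Row
FP (suc d) = List (FP d)

_≈FP_ : ∀ {d} → FP d → FP d → Set
_≈FP_ {zero}  xs ys = Permutation _≈R_ xs ys
_≈FP_ {suc d} xs ys = Permutation (_≈FP_ {d}) xs ys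

-- s^k_G(i_1,…,i_q) with d = k - q remaining levels, tuple t = (i_1,…,i_q).
fpAux : (G : Graph) → (d : ℕ) → List (Fin (n G)) → FP d
fpAux G zero    t = map (λ i l → L G t l i) (allFin (n G))
fpAux G (suc d) t =
  map (λ i′ → fpAux G d (t ++ [ i′ ]))
      (filter (λ i′ → ¬? (i′ ∈? t)) (allFin (n G)))
  where open import Data.List.Membership.DecPropositional (_≟_ {n = n G}) using (_∈?_)

fingerprint : (k : ℕ) → Graph → FP k
fingerprint k G = fpAux G k []

-- Fix u. Its closed neighbourhood in G and its neighbourhood in the complement
-- partition the vertex set, so for every l the multiset of the L_l-labels of the
-- complement-neighbours of u is the l-th column of M minus L_l(u) and the
-- multiset of the L_l-labels of the G-neighbours of u. Matrices that agree up to
-- row permutation have the same column multisets, and L_{l+1}(u) determines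
-- L_l(u) and that multiset, so by induction on l equal G-labels of two vertices
-- force equal complement-labels. Transporting along the permutations that
-- witness equality of the nested multisets gives one direction; complementation
-- is an involution, which gives the other.
module Submission where

open import Defs
open import Data.Nat using (ℕ; _≤_)
open import Function.Bundles using (_⇔_)

open import Level using (Level)
open import Function.Base using (_∘_)
open import Function.Bundles using (mk⇔)
open import Data.Nat using (zero; suc)
open import Data.Fin using (Fin; _≟_)
open import Data.Bool using (Bool; true; false; not; _∧_; T; T?)
open import Data.Bool.Properties using (not-involutive)
open import Data.List using (List; []; _∷_; [_]; map; _++_; filterᵇ; allFin)
open import Data.List.Properties using (map-++; map-cong; filter-none; filter-reject; filter-accept; filter-≐)
open import Data.List.Membership.Propositional using (_∈_)
open import Data.List.Membership.Propositional.Properties using (∈-allFin)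
open import Data.List.Relation.Unary.Any using (here; there)
import Data.List.Relation.Unary.All as All
open import Data.List.Relation.Unary.AllPairs using (_∷_)
open import Data.List.Relation.Unary.Unique.Propositional using (Unique)
open import Data.List.Relation.Unary.Unique.Propositional.Properties using (allFin⁺)
open import Data.List.Relation.Binary.Pointwise as Pointwise using (Pointwise; []; _∷_)
open import Data.List.Relation.Binary.Permutation.Homogeneous as Homogeneous using (Permutation)
open import Data.List.Relation.Binary.Permutation.Propositional as Propositional using (_↭_; ↭⇒↭ₛ′)
open import Data.List.Relation.Binary.Permutation.Propositional.Properties using (map⁺; ↭-map-inv; shift; ++⁺ˡ)
import Data.List.Relation.Binary.Permutation.Setoid.Properties as SetoidPermutation
open import Data.Product using (∃; _×_; _,_)
open import Relation.Binary.Core using (Rel)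
open import Relation.Binary.Bundles using (Setoid)
open import Relation.Binary.Structures using (IsEquivalence)
open import Relation.Binary.Definitions using (Transitive)
open import Relation.Binary.PropositionalEquality as ≡ using (_≡_; refl; cong; cong₂; subst)
open import Relation.Nullary.Decidable using (yes; no)

private variable
  a b c d r s : Level
  A : Set a
  B : Set b
  C : Set c
  D : Set d

module _ {R : Rel A r} where

  ↭-Pointwise-commute : {xs ys zs : List A} → xs ↭ ys → Pointwise R ys zs →
                        ∃ λ ws → Pointwise R xs ws × ws ↭ zs
  ↭-Pointwise-commute {zs = zs} Propositional.refl ys≋zs = zs , ys≋zs , Propositional.refl
  ↭-Pointwise-commute (Propositional.prep _ p) (_∷_ {y = z} r ys≋zs)
    with ws , xs≋ws , ws↭ ← ↭-Pointwise-commute p ys≋zs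
    = z ∷ ws , r ∷ xs≋ws , Propositional.prep z ws↭
  ↭-Pointwise-commute (Propositional.swap _ _ p) (_∷_ {y = z₁} r₁ (_∷_ {y = z₂} r₂ ys≋zs))
    with ws , xs≋ws , ws↭ ← ↭-Pointwise-commute p ys≋zs
    = z₂ ∷ z₁ ∷ ws , r₂ ∷ r₁ ∷ xs≋ws , Propositional.swap z₂ z₁ ws↭
  ↭-Pointwise-commute (Propositional.trans p q) ys≋zs
    with vs , ≋vs , vs↭ ← ↭-Pointwise-commute q ys≋zs
    with ws , ≋ws , ws↭ ← ↭-Pointwise-commute p ≋vs
    = ws , ≋ws , Propositional.trans ws↭ vs↭

  Permutation⇒Pointwise-↭ : Transitive R → {xs ys : List A} → Permutation R xs ys →
                            ∃ λ zs → Pointwise R xs zs × zs ↭ ys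
  Permutation⇒Pointwise-↭ R-trans {ys = ys} (Homogeneous.refl xs≋ys) = ys , xs≋ys , Propositional.refl
  Permutation⇒Pointwise-↭ R-trans (Homogeneous.prep {y = y} r p)
    with zs , ≋zs , zs↭ ← Permutation⇒Pointwise-↭ R-trans p
    = y ∷ zs , r ∷ ≋zs , Propositional.prep y zs↭
  Permutation⇒Pointwise-↭ R-trans (Homogeneous.swap {x′ = x′} {y′ = y′} r₁ r₂ p)
    with zs , ≋zs , zs↭ ← Permutation⇒Pointwise-↭ R-trans p
    = x′ ∷ y′ ∷ zs , r₁ ∷ r₂ ∷ ≋zs , Propositional.swap x′ y′ zs↭
  Permutation⇒Pointwise-↭ R-trans (Homogeneous.trans p q)
    with zs₁ , ≋zs₁ , zs₁↭ ← Permutation⇒Pointwise-↭ R-trans p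
    with zs₂ , ≋zs₂ , zs₂↭ ← Permutation⇒Pointwise-↭ R-trans q
    with zs₃ , ≋zs₃ , zs₃↭ ← ↭-Pointwise-commute zs₁↭ ≋zs₂
    = zs₃ , Pointwise.transitive R-trans ≋zs₁ ≋zs₃ , Propositional.trans zs₃↭ zs₂↭

Permutation-transfer : {R : Rel C r} {S : Rel D s} → Transitive R → IsEquivalence S →
  (f : A → C) (g : B → C) (f′ : A → D) (g′ : B → D) →
  (∀ {x y} → R (f x) (g y) → S (f′ x) (g′ y)) →
  ∀ xs ys → Permutation R (map f xs) (map g ys) → Permutation S (map f′ xs) (map g′ ys)
Permutation-transfer R-trans S-equiv f g f′ g′ transfer xs ys p
  with zs , ≋zs , zs↭ ← Permutation⇒Pointwise-↭ R-trans p
  with ys′ , refl , ys↭ys′ ← ↭-map-inv g (Propositional.↭-sym zs↭)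
  = Homogeneous.trans
      (Homogeneous.refl (Pointwise.map⁺ f′ g′ (Pointwise.map transfer (Pointwise.map⁻ f g ≋zs))))
      (↭⇒↭ₛ′ S-equiv (map⁺ g′ (Propositional.↭-sym ys↭ys′)))

mutual
  ≈L-refl : ∀ x → x ≈L x
  ≈L-refl (base c) = base refl
  ≈L-refl (step a xs) = step (≈L-refl a) (Homogeneous.refl (Pointwise-≈L-refl xs))

  Pointwise-≈L-refl : ∀ xs → Pointwise _≈L_ xs xs
  Pointwise-≈L-refl [] = []
  Pointwise-≈L-refl (x ∷ xs) = ≈L-refl x ∷ Pointwise-≈L-refl xs

mutual
  ≈L-sym : ∀ {x y} → x ≈L y → y ≈L x
  ≈L-sym (base p) = base (≡.sym p)
  ≈L-sym (step a p) = step (≈L-sym a) (Permutation-≈L-sym p)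

  Permutation-≈L-sym : ∀ {xs ys} → Permutation _≈L_ xs ys → Permutation _≈L_ ys xs
  Permutation-≈L-sym (Homogeneous.refl xs≋ys) = Homogeneous.refl (Pointwise-≈L-sym xs≋ys)
  Permutation-≈L-sym (Homogeneous.prep r p) = Homogeneous.prep (≈L-sym r) (Permutation-≈L-sym p)
  Permutation-≈L-sym (Homogeneous.swap r₁ r₂ p) =
    Homogeneous.swap (≈L-sym r₂) (≈L-sym r₁) (Permutation-≈L-sym p)
  Permutation-≈L-sym (Homogeneous.trans p q) =
    Homogeneous.trans (Permutation-≈L-sym q) (Permutation-≈L-sym p)

  Pointwise-≈L-sym : ∀ {xs ys} → Pointwise _≈L_ xs ys → Pointwise _≈L_ ys xs
  Pointwise-≈L-sym [] = []
  Pointwise-≈L-sym (r ∷ rs) = ≈L-sym r ∷ Pointwise-≈L-sym rs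

≈L-trans : ∀ {x y z} → x ≈L y → y ≈L z → x ≈L z
≈L-trans (base p) (base q) = base (≡.trans p q)
≈L-trans (step a p) (step b q) = step (≈L-trans a b) (Homogeneous.trans p q)

≈L-isEquivalence : IsEquivalence _≈L_
≈L-isEquivalence = record { refl = ≈L-refl _ ; sym = ≈L-sym ; trans = ≈L-trans }

Label-setoid : Setoid _ _
Label-setoid = record { isEquivalence = ≈L-isEquivalence }

≈R-isEquivalence : IsEquivalence _≈R_
≈R-isEquivalence = record
  { refl  = λ l → ≈L-refl _
  ; sym   = λ r≈s l → ≈L-sym (r≈s l)
  ; trans = λ r≈s s≈u l → ≈L-trans (r≈s l) (s≈u l)
  }

≈FP-isEquivalence : ∀ d → IsEquivalence (_≈FP_ {d})
≈FP-isEquivalence zero = Homogeneous.isEquivalence ≈R.refl ≈R.sym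
  where module ≈R = IsEquivalence ≈R-isEquivalence
≈FP-isEquivalence (suc d) = Homogeneous.isEquivalence ≈FP.refl ≈FP.sym
  where module ≈FP = IsEquivalence (≈FP-isEquivalence d)

module _ (S : Setoid c s) where
  open Setoid S using (Carrier)
  open SetoidPermutation S using (++⁺ʳ; dropMiddle)
  open import Data.List.Relation.Binary.Permutation.Setoid S using () renaming (_↭_ to _↭ₛ_)

  ↭-cancelˡ : {ws xs ys zs : List Carrier} → ws ↭ₛ xs → ws ++ ys ↭ₛ xs ++ zs → ys ↭ₛ zs
  ↭-cancelˡ {zs = zs} ws↭xs p =
    dropMiddle [] [] (Homogeneous.trans p (Homogeneous.sym (Setoid.sym S) (++⁺ʳ zs ws↭xs)))

filterᵇ-three-way-↭ : (p q : A → Bool) → (∀ x → T (p x) → q x ≡ false) → (xs : List A) →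
  xs ↭ filterᵇ p xs ++ filterᵇ q xs ++ filterᵇ (λ x → not (p x) ∧ not (q x)) xs
filterᵇ-three-way-↭ p q disjoint [] = Propositional.refl
filterᵇ-three-way-↭ p q disjoint (x ∷ xs) with p x in px | q x in qx
... | true  | true  with () ← ≡.trans (≡.sym qx) (disjoint x (subst T (≡.sym px) _))
... | true  | false = Propositional.prep x (filterᵇ-three-way-↭ p q disjoint xs)
... | false | true  =
  Propositional.trans (Propositional.prep x (filterᵇ-three-way-↭ p q disjoint xs))
    (Propositional.↭-sym (shift x (filterᵇ p xs) _))
... | false | false =
  Propositional.trans (Propositional.prep x (filterᵇ-three-way-↭ p q disjoint xs))
    (Propositional.↭-sym (Propositional.trans (++⁺ˡ (filterᵇ p xs) (shift x (filterᵇ q xs) _))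
                                              (shift x (filterᵇ p xs) _)))

T-==⇒≡ : ∀ {m} {i j : Fin m} → T (i == j) → i ≡ j
T-==⇒≡ {i = i} {j} i==j with i ≟ j
... | yes i≡j = i≡j

filterᵇ-==-Unique : ∀ {m} {u : Fin m} {xs} → Unique xs → u ∈ xs → filterᵇ (u ==_) xs ≡ [ u ]
filterᵇ-==-Unique {u = u} (u∉ ∷ _) (here refl) =
  ≡.trans (filter-accept (λ y → T? (u == y)) (subst T (≡.sym (==-refl u)) _))
          (cong (u ∷_) (filter-none (λ y → T? (u == y)) (All.map (_∘ T-==⇒≡) u∉)))
filterᵇ-==-Unique {u = u} (x∉ ∷ xs-unique) (there u∈) =
  ≡.trans (filter-reject (λ y → T? (u == y)) (λ u≡x → All.lookup x∉ u∈ (≡.sym (T-==⇒≡ u≡x))))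
          (filterᵇ-==-Unique xs-unique u∈)

closedNeighbourhood-↭ : (G : Graph) (u : Fin (n G)) →
  allFin (n G) ↭ u ∷ neighbours G u ++ neighbours (complement G) u
closedNeighbourhood-↭ G u =
  subst (λ us → allFin (n G) ↭ us ++ neighbours G u ++ neighbours (complement G) u)
    (filterᵇ-==-Unique (allFin⁺ (n G)) (∈-allFin u))
    (filterᵇ-three-way-↭ (u ==_) (adj G u) non-loop (allFin (n G)))
  where
  non-loop : ∀ j → T (u == j) → adj G u j ≡ false
  non-loop j u==j = subst (λ j → adj G u j ≡ false) (T-==⇒≡ u==j) (irr G u)

column : (G : Graph) → List (Fin (n G)) → ℕ → List Label
column G t l = map (L G t l) (allFin (n G))

column-split : (G : Graph) (t : List (Fin (n G))) (l : ℕ) (u : Fin (n G)) →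
  Permutation _≈L_ (column G t l)
    (L G t l u ∷ map (L G t l) (neighbours G u) ++ map (L G t l) (neighbours (complement G) u))
column-split G t l u = ↭⇒↭ₛ′ ≈L-isEquivalence
  (subst (λ ls → column G t l ↭ L G t l u ∷ ls)
    (map-++ (L G t l) (neighbours G u) (neighbours (complement G) u))
    (map⁺ (L G t l) (closedNeighbourhood-↭ G u)))

module _ (G₁ G₂ : Graph) (t₁ : List (Fin (n G₁))) (t₂ : List (Fin (n G₂)))
         (columns≈ : ∀ l → Permutation _≈L_ (column G₁ t₁ l) (column G₂ t₂ l)) where

  complement-≈L : ∀ l {u v} → L G₁ t₁ l u ≈L L G₂ t₂ l v →
                  L (complement G₁) t₁ l u ≈L L (complement G₂) t₂ l v
  complement-≈L zero u≈v = u≈v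
  complement-≈L (suc l) {u} {v} (step u≈v neighbours≈) =
    step (complement-≈L l u≈v)
      (Permutation-transfer ≈L-trans ≈L-isEquivalence
        (L G₁ t₁ l) (L G₂ t₂ l) (L (complement G₁) t₁ l) (L (complement G₂) t₂ l)
        (complement-≈L l) (neighbours (complement G₁) u) (neighbours (complement G₂) v)
        (↭-cancelˡ Label-setoid (Homogeneous.prep u≈v neighbours≈)
          (Homogeneous.trans (Permutation-≈L-sym (column-split G₁ t₁ l u))
            (Homogeneous.trans (columns≈ l) (column-split G₂ t₂ l v)))))

fpAux-complement : (G₁ G₂ : Graph) (d : ℕ) (t₁ : List (Fin (n G₁))) (t₂ : List (Fin (n G₂))) →
  _≈FP_ {d} (fpAux G₁ d t₁) (fpAux G₂ d t₂) →
  _≈FP_ {d} (fpAux (complement G₁) d t₁) (fpAux (complement G₂) d t₂)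
fpAux-complement G₁ G₂ zero t₁ t₂ rows≈ =
  Permutation-transfer ≈R.trans ≈R-isEquivalence _ _ _ _
    (λ u≈v l → complement-≈L G₁ G₂ t₁ t₂ columns≈ l (u≈v l)) (allFin (n G₁)) (allFin (n G₂)) rows≈
  where
  module ≈R = IsEquivalence ≈R-isEquivalence
  columns≈ : ∀ l → Permutation _≈L_ (column G₁ t₁ l) (column G₂ t₂ l)
  columns≈ l = Permutation-transfer ≈R.trans ≈L-isEquivalence _ _ (L G₁ t₁ l) (L G₂ t₂ l)
    (λ u≈v → u≈v l) (allFin (n G₁)) (allFin (n G₂)) rows≈
fpAux-complement G₁ G₂ (suc d) t₁ t₂ ≈fp =
  Permutation-transfer ≈FP.trans (≈FP-isEquivalence d) _ _ _ _
    (fpAux-complement G₁ G₂ d _ _) _ _ ≈fp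
  where module ≈FP = IsEquivalence (≈FP-isEquivalence d)

adj-complement-involutive : (G : Graph) (i j : Fin (n G)) →
  adj (complement (complement G)) i j ≡ adj G i j
adj-complement-involutive G i j with i ≟ j
... | yes refl = ≡.sym (irr G i)
... | no _     = not-involutive (adj G i j)

L-complement-involutive : (G : Graph) (t : List (Fin (n G))) (l : ℕ) (i : Fin (n G)) →
  L (complement (complement G)) t l i ≡ L G t l i
L-complement-involutive G t zero i = refl
L-complement-involutive G t (suc l) i = cong₂ step (L-complement-involutive G t l i) (begin
  map (L (complement (complement G)) t l) (neighbours (complement (complement G)) i)
    ≡⟨ map-cong (L-complement-involutive G t l) _ ⟩
  map (L G t l) (neighbours (complement (complement G)) i)
    ≡⟨ cong (map (L G t l)) (filter-≐ _ _ (same-adj , same-adj⁻¹) (allFin (n G))) ⟩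
  map (L G t l) (neighbours G i) ∎)
  where
  open ≡.≡-Reasoning
  same-adj : ∀ {j} → T (adj (complement (complement G)) i j) → T (adj G i j)
  same-adj {j} = subst T (adj-complement-involutive G i j)
  same-adj⁻¹ : ∀ {j} → T (adj G i j) → T (adj (complement (complement G)) i j)
  same-adj⁻¹ {j} = subst T (≡.sym (adj-complement-involutive G i j))

map-Pointwise : {R : Rel B r} (f g : A → B) → (∀ x → R (f x) (g x)) →
                ∀ xs → Pointwise R (map f xs) (map g xs)
map-Pointwise f g f≈g []       = []
map-Pointwise f g f≈g (x ∷ xs) = f≈g x ∷ map-Pointwise f g f≈g xs

fpAux-complement-involutive : (G : Graph) (d : ℕ) (t : List (Fin (n G))) →
  _≈FP_ {d} (fpAux (complement (complement G)) d t) (fpAux G d t)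
fpAux-complement-involutive G zero t = Homogeneous.refl
  (map-Pointwise _ _ (λ i l → IsEquivalence.reflexive ≈L-isEquivalence (L-complement-involutive G t l i))
    (allFin (n G)))
fpAux-complement-involutive G (suc d) t = Homogeneous.refl
  (map-Pointwise _ _ (λ i → fpAux-complement-involutive G d (t ++ [ i ])) _)

theorem12 : (G₁ G₂ : Graph) (k : ℕ) → 1 ≤ k →
    (fingerprint k G₁ ≈FP fingerprint k G₂)
    ⇔ (fingerprint k (complement G₁) ≈FP fingerprint k (complement G₂))
theorem12 G₁ G₂ k _ = mk⇔
  (fpAux-complement G₁ G₂ k [] [])
  (λ ≈fp̄ → trans (sym (fpAux-complement-involutive G₁ k []))
             (trans (fpAux-complement (complement G₁) (complement G₂) k [] [] ≈fp̄)
                    (fpAux-complement-involutive G₂ k [])))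
  where open IsEquivalence (≈FP-isEquivalence k)
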